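{- Let $n>2$ and $m\geq 2$ be integers, and let $Q(n,m)$ be the graph obtained from the complete graph $K_n$ and $n$ disjoint copies of $K_m$ by identifying each vertex of $K_n$ with a vertex of its own copy of $K_m$ (equivalently, $Q(n,m)=K_n\circ K_{m-1}$). Then $\pi(Q(n,m))=mn+n+2$ and $\pi^{*}(Q(n,m))=4$.
   Context: Let $G=(V,E)$ be a simple connected graph. A configuration is a function $f:V\to\mathbb{N}\cup\{0\}$, with weight $|f|=\sum_{u\in V}f(u)$. A pebbling step from a vertex $u$ to a neighbor $v$ decreases $f(u)$ by two and increases $f(v)$ by one. A configuration is solvable if for every vertex $v$ there is a (possibly empty) sequence of pebbling steps resulting in at least one pebble on $v$. The pebbling number $\pi(G)$ is the minimum $k$ such that every configuration of weight $k$ is solvable, and the optimal pebbling number $\pi^{*}(G)$ is the minimum weight of a solvable configuration. The corona product $G\circ H$ is obtained from one copy of $G$ and $|V(G)|$ copies of $H$ by joining the $i$-th vertex of $G$ to every vertex of the $i$-th copy of $H$. -}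

module Defs where

open import Data.Nat using (ℕ; zero; suc; _+_; _*_; _∸_; _≤_; _<_)
open import Data.Fin using (Fin; remQuot; toℕ)
open import Data.Fin.Properties using (_≟_)
open import Data.List using (map; allFin)
open import Data.Nat.ListAction using (sum)
open import Data.Product using (Σ; ∃; _×_; _,_)
open import Data.Sum using (_⊎_)
open import Relation.Nullary using (¬_; yes; no)
open import Relation.Binary.PropositionalEquality using (_≡_)
open import Relation.Binary.Construct.Closure.ReflexiveTransitive using (Star)

record Graph : Set₁ where
  field
    N   : ℕ
    Adj : Fin N → Fin N → Set

module Pebbling (G : Graph) where
  open Graph G

  Config : Set
  Config = Fin N → ℕ

  weight : Config → ℕ
  weight f = sum (map f (allFin N))

  move : Config → Fin N → Fin N → Config
  move f u v w with w ≟ u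
  ... | yes _ = f u ∸ 2
  ... | no _ with w ≟ v
  ...   | yes _ = suc (f v)
  ...   | no _  = f w

  Step : Config → Config → Set
  Step f g = Σ (Fin N) λ u → Σ (Fin N) λ v →
             Adj u v × 2 ≤ f u × (∀ w → g w ≡ move f u v w)

  Reach : Config → Config → Set
  Reach = Star Step

  Solvable : Config → Set
  Solvable f = ∀ v → ∃ λ g → Reach f g × 1 ≤ g v

  IsPebblingNumber : ℕ → Set
  IsPebblingNumber k =
    (∀ f → weight f ≡ k → Solvable f) ×
    (∀ j → j < k → ∃ λ f → weight f ≡ j × ¬ Solvable f)

  IsOptimalPebblingNumber : ℕ → Set
  IsOptimalPebblingNumber k =
    (∃ λ f → weight f ≡ k × Solvable f) ×
    (∀ f → Solvable f → k ≤ weight f)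

-- Q(n,m): vertex (i , a) ∈ Fin n × Fin m (encoded in Fin (n * m) via remQuot),
-- i indexes the copy of K_m, a = 0 is the vertex identified with vertex i of K_n.
QAdj : ∀ n m → Fin n × Fin m → Fin n × Fin m → Set
QAdj n m (i , a) (j , b) =
  (i ≡ j × ¬ a ≡ b) ⊎ (¬ i ≡ j × toℕ a ≡ 0 × toℕ b ≡ 0)

Q : ℕ → ℕ → Graph
Q n m = record { N = n * m ; Adj = λ x y → QAdj n m (remQuot m x) (remQuot m y) }

{-# OPTIONS --safe #-}
-- Call the copies of K m the rows of Q n m and their vertices in K n the roots.  A row can
-- gather pebbles on its root and export half of them to another root, so the pebbles
-- collectible at root i are those on it plus the exports of the other rows, and a greedy
-- sequence of moves achieves this.  A row holds at most 4 export + m + 1 pebbles; hence with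
-- mn + n + 2 pebbles every vertex is reached, directly if its row has a vertex with two
-- pebbles, and otherwise through its root, where one (two, for a leaf) pebble is collectible.
-- Conversely, if every leaf of row i holds at most one pebble and at most one pebble is
-- collectible at root i, then row i never fires and no move elsewhere breaks this, so an
-- empty leaf of row i stays empty.  This blocks a configuration of weight mn + n + 1 (seven
-- pebbles on a leaf of row 1, three on a leaf of each later row, one on every other leaf
-- except a leaf of row 0), and every configuration of three pebbles in which a move is
-- possible, since it leaves a whole row empty.  Four pebbles on one root reach every vertex.
module Submission where

open import Defs
open import Data.Nat using (ℕ; zero; suc; _+_; _*_; _∸_; _≤_; _<_; z≤n; s≤s; ⌊_/2⌋; _≤?_)
open import Data.Nat.Properties hiding (_≟_; suc-injective)
open import Data.Nat.Induction using (<-wellFounded)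
open import Data.Nat.Tactic.RingSolver using (solve-∀)
import Data.Nat.ListAction as List
open import Data.Fin using (Fin; zero; suc; punchIn; punchOut; _↑ˡ_; _↑ʳ_; combine; remQuot)
open import Data.Fin.Properties
  using (_≟_; any?; suc-injective; toℕ-injective; remQuot-combine; combine-remQuot;
         punchInᵢ≢i; punchIn-punchOut; punchIn-injective)
open import Data.Vec.Functional using (Vector; removeAt; _∷_)
import Data.List as List using (map; tabulate; allFin)
import Data.List.Properties as List using (map-tabulate)
open import Data.Product using (∃; _×_; _,_; proj₁; proj₂; uncurry)
open import Data.Sum using (inj₁; inj₂)
open import Function using (_∘_)
open import Function.Definitions using (Injective)
open import Induction.WellFounded using (Acc; acc)
open import Relation.Nullary using (¬_; ¬?; yes; no; contradiction)
open import Relation.Nullary.Decidable using (_×-dec_)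
open import Relation.Binary.PropositionalEquality
open import Relation.Binary.Construct.Closure.ReflexiveTransitive using (ε; _◅_; _◅◅_)
open import Algebra.Properties.Semiring.Sum +-*-semiring
  using (sum; sum-cong-≗; sum-remove; ∑-distrib-+; *-distribˡ-sum)

sum-const : ∀ k c → sum {k} (λ _ → c) ≡ k * c
sum-const zero    c = refl
sum-const (suc k) c = cong (c +_) (sum-const k c)

sum-zero : ∀ k → sum {k} (λ _ → 0) ≡ 0
sum-zero k = trans (sum-const k 0) (*-zeroʳ k)

sum-mono : ∀ {k} {φ ψ : Vector ℕ k} → (∀ x → ψ x ≤ φ x) → sum ψ ≤ sum φ
sum-mono {zero}  _   = z≤n
sum-mono {suc k} ψ≤φ = +-mono-≤ (ψ≤φ zero) (sum-mono (ψ≤φ ∘ suc))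

≤-with-offsets : ∀ {a b r s d e} → a + d ≤ b + e → r ≤ s → a + r + d ≤ b + s + e
≤-with-offsets {a} {b} {r} {s} {d} {e} ad≤be r≤s = begin
  a + r + d   ≡⟨ +-comm-middle a r d ⟩
  a + d + r   ≤⟨ +-mono-≤ ad≤be r≤s ⟩
  b + e + s   ≡⟨ +-comm-middle b e s ⟩
  b + s + e   ∎
  where
  open ≤-Reasoning
  +-comm-middle : ∀ x y z → x + y + z ≡ x + z + y
  +-comm-middle = solve-∀

≤-sum : ∀ {k} (φ : Vector ℕ k) p → φ p ≤ sum φ
≤-sum {suc k} φ p = subst (φ p ≤_) (sym (sum-remove {i = p} φ)) (m≤m+n (φ p) _)

sum-≤-except : ∀ {k} {φ ψ : Vector ℕ k} (p : Fin k) {d e} →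
               (∀ x → x ≢ p → ψ x ≤ φ x) → ψ p + d ≤ φ p + e → sum ψ + d ≤ sum φ + e
sum-≤-except {suc k} {φ} {ψ} p {d} {e} ψ≤φ here = begin
  sum ψ + d                      ≡⟨ cong (_+ d) (sum-remove {i = p} ψ) ⟩
  ψ p + sum (removeAt ψ p) + d   ≤⟨ ≤-with-offsets {ψ p} {φ p} here (sum-mono rest) ⟩
  φ p + sum (removeAt φ p) + e   ≡⟨ cong (_+ e) (sum-remove {i = p} φ) ⟨
  sum φ + e                      ∎
  where
  open ≤-Reasoning
  rest : ∀ x → removeAt ψ p x ≤ removeAt φ p x
  rest x = ψ≤φ _ (punchInᵢ≢i p x)

sum-≡-except : ∀ {k} {φ ψ : Vector ℕ k} (p : Fin k) {d e} →
               (∀ x → x ≢ p → ψ x ≡ φ x) → ψ p + d ≡ φ p + e → sum ψ + d ≡ sum φ + e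
sum-≡-except p ψ≡φ here = ≤-antisym
  (sum-≤-except p (λ x x≢p → ≤-reflexive (ψ≡φ x x≢p)) (≤-reflexive here))
  (sum-≤-except p (λ x x≢p → ≤-reflexive (sym (ψ≡φ x x≢p))) (≤-reflexive (sym here)))

sum-≤-except₂ : ∀ {k} {φ ψ : Vector ℕ k} {p q : Fin k} {d e} → p ≢ q →
                (∀ x → x ≢ p → x ≢ q → ψ x ≤ φ x) →
                ψ p + ψ q + d ≤ φ p + φ q + e → sum ψ + d ≤ sum φ + e
sum-≤-except₂ {suc k} {φ} {ψ} {p} {q} {d} {e} p≢q ψ≤φ here = begin
  sum ψ + d                        ≡⟨ cong (_+ d) (sum-remove {i = p} ψ) ⟩
  ψ p + sum (removeAt ψ p) + d     ≡⟨ swap-front (ψ p) _ d ⟩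
  sum (removeAt ψ p) + (ψ p + d)   ≤⟨ sum-≤-except q′ rest here′ ⟩
  sum (removeAt φ p) + (φ p + e)   ≡⟨ swap-front (φ p) _ e ⟨
  φ p + sum (removeAt φ p) + e     ≡⟨ cong (_+ e) (sum-remove {i = p} φ) ⟨
  sum φ + e                        ∎
  where
  open ≤-Reasoning
  swap-front : ∀ a b c → a + b + c ≡ b + (a + c)
  swap-front = solve-∀
  q′ = punchOut p≢q
  q′↦q : punchIn p q′ ≡ q
  q′↦q = punchIn-punchOut p≢q
  rest : ∀ x → x ≢ q′ → removeAt ψ p x ≤ removeAt φ p x
  rest x x≢q′ = ψ≤φ _ (punchInᵢ≢i p x)
    λ x↦q → x≢q′ (punchIn-injective p x q′ (trans x↦q (sym q′↦q)))
  here′ : removeAt ψ p q′ + (ψ p + d) ≤ removeAt φ p q′ + (φ p + e)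
  here′ rewrite q′↦q = subst₂ _≤_ (swap-front (ψ p) (ψ q) d) (swap-front (φ p) (φ q) e) here

sum-≤-pair : ∀ {k} {φ ψ : Vector ℕ k} {p q : Fin k} → p ≢ q → (∀ x → x ≢ p → x ≢ q → ψ x ≤ φ x) →
             ψ p + ψ q ≤ φ p + φ q → sum ψ ≤ sum φ
sum-≤-pair p≢q ψ≤φ here =
  subst₂ _≤_ (+-identityʳ _) (+-identityʳ _) (sum-≤-except₂ p≢q ψ≤φ (+-monoˡ-≤ 0 here))

sum-≤1 : ∀ {k} {φ : Vector ℕ k} → (∀ x → φ x ≤ 1) → sum φ ≤ k
sum-≤1 {k} φ≤1 = ≤-trans (sum-mono φ≤1) (≤-reflexive (trans (sum-const k 1) (*-identityʳ k)))

sum-≤1-gap : ∀ {k} {φ : Vector ℕ k} {p} → (∀ x → φ x ≤ 1) → φ p ≡ 0 → sum φ < k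
sum-≤1-gap {k} {φ} {p} φ≤1 φp≡0 = subst₂ _≤_ (+-comm (sum φ) 1)
  (trans (+-identityʳ _) (trans (sum-const k 1) (*-identityʳ k)))
  (sum-≤-except p (λ x _ → φ≤1 x) (≤-reflexive (cong (_+ 1) φp≡0)))

sum<⇒∃≡0 : ∀ {k} (φ : Vector ℕ k) → sum φ < k → ∃ λ x → φ x ≡ 0
sum<⇒∃≡0 {suc k} φ s<k with φ zero in φ₀≡
... | zero  = zero , φ₀≡
... | suc a = let x , φx≡0 = sum<⇒∃≡0 (φ ∘ suc) (≤-trans (s≤s (m≤n+m _ a)) (≤-pred s<k))
              in suc x , φx≡0

≤sum⇒∃below : ∀ {k} (φ : Vector ℕ k) {j} → j ≤ sum φ →
              ∃ λ ψ → (∀ x → ψ x ≤ φ x) × sum ψ ≡ j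
≤sum⇒∃below {zero}  φ z≤n = φ , (λ ()) , refl
≤sum⇒∃below {suc k} φ {j} j≤ with j ≤? sum (φ ∘ suc)
... | yes j≤tail = let ψ , ψ≤ , ∑ψ≡j = ≤sum⇒∃below (φ ∘ suc) j≤tail
                   in (0 ∷ ψ) , (λ { zero → z≤n ; (suc x) → ψ≤ x }) , ∑ψ≡j
... | no  j≰tail = ((j ∸ tail) ∷ (φ ∘ suc)) , head≤ , m∸n+n≡m (≰⇒≥ j≰tail)
  where
  tail = sum (φ ∘ suc)
  head≤ : ∀ x → ((j ∸ tail) ∷ (φ ∘ suc)) x ≤ φ x
  head≤ zero    = subst (j ∸ tail ≤_) (m+n∸n≡m (φ zero) tail) (∸-monoˡ-≤ tail j≤)
  head≤ (suc x) = ≤-refl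

sum-↑ : ∀ a {b} (φ : Vector ℕ (a + b)) → sum φ ≡ sum (φ ∘ (_↑ˡ b)) + sum (φ ∘ (a ↑ʳ_))
sum-↑ zero    φ = refl
sum-↑ (suc a) φ = trans (cong (φ zero +_) (sum-↑ a (φ ∘ suc))) (sym (+-assoc (φ zero) _ _))

sum-combine : ∀ n {m} (φ : Vector ℕ (n * m)) → sum φ ≡ sum {n} λ j → sum {m} λ a → φ (combine j a)
sum-combine zero    φ = refl
sum-combine (suc n) {m} φ =
  trans (sum-↑ m φ) (cong (sum (φ ∘ combine {suc n} zero) +_) (sum-combine n (φ ∘ (m ↑ʳ_))))

sum-allFin : ∀ k (φ : Vector ℕ k) → List.sum (List.map φ (List.allFin k)) ≡ sum φ
sum-allFin k φ = trans (cong List.sum (List.map-tabulate (λ x → x) φ)) (sum-tabulate k φ)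
  where
  sum-tabulate : ∀ k (φ : Vector ℕ k) → List.sum (List.tabulate φ) ≡ sum φ
  sum-tabulate zero    φ = refl
  sum-tabulate (suc k) φ = cong (φ zero +_) (sum-tabulate k (φ ∘ suc))

record Moved {A : Set} (φ ψ : A → ℕ) (p q : A) : Set where
  field
    source : ψ p ≡ φ p ∸ 2
    target : ψ q ≡ suc (φ q)
    others : ∀ x → x ≢ p → x ≢ q → ψ x ≡ φ x

Moved-reindex : ∀ {A B : Set} {φ ψ : A → ℕ} {p q} {h : B → A} {p′ q′} → Injective _≡_ _≡_ h →
                h p′ ≡ p → h q′ ≡ q → Moved φ ψ p q → Moved (φ ∘ h) (ψ ∘ h) p′ q′
Moved-reindex h-inj refl refl moved = record
  { source = source
  ; target = target
  ; others = λ x x≢p′ x≢q′ → others _ (x≢p′ ∘ h-inj) (x≢q′ ∘ h-inj)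
  }
  where open Moved moved

sum-Moved-< : ∀ {k} {φ ψ : Vector ℕ k} {p q} → Moved φ ψ p q → p ≢ q → 2 ≤ φ p → sum ψ < sum φ
sum-Moved-< {φ = φ} {ψ} {p} {q} moved p≢q 2≤φp =
  subst₂ _≤_ (+-comm (sum ψ) 1) (+-identityʳ (sum φ))
    (sum-≤-except₂ p≢q (λ x x≢p x≢q → ≤-reflexive (others x x≢p x≢q)) pair)
  where
  open Moved moved
  pair : ψ p + ψ q + 1 ≤ φ p + φ q + 0
  pair rewrite source | target = ≤-reflexive (lose-two 2≤φp)
    where
    lose-two : ∀ {x y} → 2 ≤ x → x ∸ 2 + suc y + 1 ≡ x + y + 0
    lose-two {suc (suc x)} {y} (s≤s (s≤s _)) = arith x y
      where
      arith : ∀ x y → x + suc y + 1 ≡ suc (suc x) + y + 0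
      arith = solve-∀

⌊1+n/2⌋≤1+⌊n/2⌋ : ∀ x → ⌊ suc x /2⌋ ≤ suc ⌊ x /2⌋
⌊1+n/2⌋≤1+⌊n/2⌋ zero          = z≤n
⌊1+n/2⌋≤1+⌊n/2⌋ (suc zero)    = ≤-refl
⌊1+n/2⌋≤1+⌊n/2⌋ (suc (suc x)) = s≤s (⌊1+n/2⌋≤1+⌊n/2⌋ x)

2*⌊n/2⌋≤n : ∀ x → 2 * ⌊ x /2⌋ ≤ x
2*⌊n/2⌋≤n zero          = z≤n
2*⌊n/2⌋≤n (suc zero)    = z≤n
2*⌊n/2⌋≤n (suc (suc x)) = subst (_≤ suc (suc x)) (sym (*-suc 2 ⌊ x /2⌋)) (s≤s (s≤s (2*⌊n/2⌋≤n x)))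

n≤2*⌊n/2⌋+1 : ∀ x → x ≤ 2 * ⌊ x /2⌋ + 1
n≤2*⌊n/2⌋+1 zero          = z≤n
n≤2*⌊n/2⌋+1 (suc zero)    = ≤-refl
n≤2*⌊n/2⌋+1 (suc (suc x)) =
  subst (suc (suc x) ≤_) (cong (_+ 1) (sym (*-suc 2 ⌊ x /2⌋))) (s≤s (s≤s (n≤2*⌊n/2⌋+1 x)))

⌊n∸2/2⌋ : ∀ {x} → 2 ≤ x → suc ⌊ x ∸ 2 /2⌋ ≡ ⌊ x /2⌋
⌊n∸2/2⌋ (s≤s (s≤s _)) = refl

module PebblingProperties (G : Graph) where
  open Graph G
  open Pebbling G

  weight≡sum : ∀ f → weight f ≡ sum f
  weight≡sum = sum-allFin N

  move-Moved : ∀ {f g u v} → u ≢ v → (∀ w → g w ≡ move f u v w) → Moved f g u v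
  move-Moved {f} {g} {u} {v} u≢v g≗ = record
    { source = trans (g≗ u) at-source
    ; target = trans (g≗ v) at-target
    ; others = λ w w≢u w≢v → trans (g≗ w) (elsewhere w w≢u w≢v)
    }
    where
    at-source : move f u v u ≡ f u ∸ 2
    at-source with u ≟ u
    ... | yes _   = refl
    ... | no  u≢u = contradiction refl u≢u
    at-target : move f u v v ≡ suc (f v)
    at-target with v ≟ u
    ... | yes v≡u = contradiction (sym v≡u) u≢v
    ... | no  _ with v ≟ v
    ...   | yes _   = refl
    ...   | no  v≢v = contradiction refl v≢v
    elsewhere : ∀ w → w ≢ u → w ≢ v → move f u v w ≡ f w
    elsewhere w w≢u w≢v with w ≟ u
    ... | yes w≡u = contradiction w≡u w≢u
    ... | no  _ with w ≟ v
    ...   | yes w≡v = contradiction w≡v w≢v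
    ...   | no  _   = refl

  weight-move-< : ∀ {f u v} → u ≢ v → 2 ≤ f u → weight (move f u v) < weight f
  weight-move-< {f} {u} {v} u≢v 2≤fu =
    subst₂ _<_ (sym (weight≡sum (move f u v))) (sym (weight≡sum f))
      (sum-Moved-< (move-Moved u≢v (λ _ → refl)) u≢v 2≤fu)

  frozen⇒¬Solvable : ∀ {f x} → ¬ (∃ λ u → 2 ≤ f u) → f x ≡ 0 → ¬ Solvable f
  frozen⇒¬Solvable {f} {x} frozen fx≡0 solvable with solvable x
  ... | _ , ε                            , 1≤fx = n≮0 (subst (1 ≤_) fx≡0 1≤fx)
  ... | _ , (u , _ , _ , 2≤fu , _) ◅ _   , _    = frozen (u , 2≤fu)

-- rootSupply ρ is the number of pebbles that moves inside the row ρ can gather on its root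
-- (vertex zero), and export ρ the number it can then send on to a neighbouring root.
Row : ℕ → Set
Row m′ = Vector ℕ (suc m′)

leafHalves : ∀ {m′} → Row m′ → Vector ℕ m′
leafHalves ρ b = ⌊ ρ (suc b) /2⌋

rootSupply : ∀ {m′} → Row m′ → ℕ
rootSupply ρ = ρ zero + sum (leafHalves ρ)

export : ∀ {m′} → Row m′ → ℕ
export ρ = ⌊ rootSupply ρ /2⌋

module _ {m′ : ℕ} where

  rootSupply-mono : ∀ {ρ σ : Row m′} → (∀ a → ρ a ≤ σ a) → rootSupply ρ ≤ rootSupply σ
  rootSupply-mono ρ≤σ = +-mono-≤ (ρ≤σ zero) (sum-mono λ b → ⌊n/2⌋-mono (ρ≤σ (suc b)))

  export-mono : ∀ {ρ σ : Row m′} → (∀ a → ρ a ≤ σ a) → export ρ ≤ export σ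
  export-mono = ⌊n/2⌋-mono ∘ rootSupply-mono

  export-≤1 : ∀ {ρ : Row m′} → (∀ a → ρ a ≤ 1) → export ρ ≡ 0
  export-≤1 ρ≤1 = n≤0⇒n≡0 (⌊n/2⌋-mono {y = 1}
    (≤-trans (rootSupply-mono ρ≤1) (≤-reflexive (cong suc (sum-zero m′)))))

  2*export≤sum : ∀ (ρ : Row m′) → 2 * export ρ ≤ sum ρ
  2*export≤sum ρ = ≤-trans (2*⌊n/2⌋≤n (rootSupply ρ))
    (+-monoʳ-≤ (ρ zero) (sum-mono λ b → ⌊n/2⌋≤n (ρ (suc b))))

  sum≤4*export : ∀ (ρ : Row m′) → sum ρ ≤ 4 * export ρ + (m′ + 2)
  sum≤4*export ρ = begin
    ρ zero + sum (ρ ∘ suc)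
      ≤⟨ +-monoʳ-≤ (ρ zero) (sum-mono λ b → n≤2*⌊n/2⌋+1 (ρ (suc b))) ⟩
    ρ zero + sum (λ b → 2 * H b + 1)
      ≡⟨ cong (ρ zero +_) (∑-distrib-+ (λ b → 2 * H b) (λ _ → 1)) ⟩
    ρ zero + (sum (λ b → 2 * H b) + sum {m′} (λ _ → 1))
      ≡⟨ cong₂ (λ s t → ρ zero + (s + t)) (sym (*-distribˡ-sum 2 H)) (sum-const m′ 1) ⟩
    ρ zero + (2 * sum H + m′ * 1)
      ≤⟨ +-monoˡ-≤ _ (m≤n*m (ρ zero) 2) ⟩
    2 * ρ zero + (2 * sum H + m′ * 1)
      ≡⟨ regroup (ρ zero) (sum H) m′ ⟩
    2 * rootSupply ρ + m′
      ≤⟨ +-monoˡ-≤ m′ (*-monoʳ-≤ 2 (n≤2*⌊n/2⌋+1 (rootSupply ρ))) ⟩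
    2 * (2 * export ρ + 1) + m′
      ≡⟨ regroup′ (export ρ) m′ ⟩
    4 * export ρ + (m′ + 2)
      ∎
    where
    open ≤-Reasoning
    H = leafHalves ρ
    regroup : ∀ r s k → 2 * r + (2 * s + k * 1) ≡ 2 * (r + s) + k
    regroup = solve-∀
    regroup′ : ∀ e k → 2 * (2 * e + 1) + k ≡ 4 * e + (k + 2)
    regroup′ = solve-∀

  module _ {ρ ρ′ : Row m′} {a a′} (moved : Moved ρ ρ′ a a′) where
    open Moved moved

    halves-others : ∀ c → suc c ≢ a → suc c ≢ a′ → leafHalves ρ′ c ≡ leafHalves ρ c
    halves-others c c≢a c≢a′ = cong ⌊_/2⌋ (others (suc c) c≢a c≢a′)

    halves-source : ∀ {b} → a ≡ suc b → 2 ≤ ρ a → suc (leafHalves ρ′ b) ≡ leafHalves ρ b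
    halves-source refl 2≤ρa = trans (cong (λ x → suc ⌊ x /2⌋) source) (⌊n∸2/2⌋ 2≤ρa)

    halves-target : ∀ {b} → a′ ≡ suc b → leafHalves ρ′ b ≤ suc (leafHalves ρ b)
    halves-target refl = subst (λ x → ⌊ x /2⌋ ≤ _) (sym target) (⌊1+n/2⌋≤1+⌊n/2⌋ (ρ a′))

  rootSupply-leafToRoot : ∀ {ρ ρ′ : Row m′} {b} → Moved ρ ρ′ (suc b) zero → 2 ≤ ρ (suc b) →
                          rootSupply ρ′ ≡ rootSupply ρ
  rootSupply-leafToRoot {ρ} {ρ′} {b} moved 2≤ρb = begin
    ρ′ zero + sum (leafHalves ρ′)         ≡⟨ cong (_+ sum (leafHalves ρ′)) (Moved.target moved) ⟩
    suc (ρ zero) + sum (leafHalves ρ′)    ≡⟨ +-suc (ρ zero) _ ⟨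
    ρ zero + suc (sum (leafHalves ρ′))    ≡⟨ cong (ρ zero +_) (trans (+-comm 1 _) halves) ⟩
    ρ zero + (sum (leafHalves ρ) + 0)     ≡⟨ cong (ρ zero +_) (+-identityʳ _) ⟩
    ρ zero + sum (leafHalves ρ)           ∎
    where
    open ≡-Reasoning
    halves : sum (leafHalves ρ′) + 1 ≡ sum (leafHalves ρ) + 0
    halves = sum-≡-except b
      (λ c c≢b → halves-others moved c (c≢b ∘ suc-injective) λ ())
      (trans (+-comm _ 1) (trans (halves-source moved refl 2≤ρb) (sym (+-identityʳ _))))

  rootSupply-Moved-≤ : ∀ {ρ ρ′ : Row m′} {a a′} → Moved ρ ρ′ a a′ → a ≢ a′ → 2 ≤ ρ a →
                       rootSupply ρ′ ≤ rootSupply ρ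
  rootSupply-Moved-≤ {a = zero}  {zero}    _     a≢a′ _   = contradiction refl a≢a′
  rootSupply-Moved-≤ {a = suc b} {zero}    moved _    2≤ρa = ≤-reflexive (rootSupply-leafToRoot moved 2≤ρa)
  rootSupply-Moved-≤ {ρ} {ρ′} {zero} {suc b} moved _ 2≤ρa = begin
    ρ′ zero + sum (leafHalves ρ′)              ≤⟨ +-mono-≤ (≤-reflexive (Moved.source moved)) halves ⟩
    (ρ zero ∸ 2) + (sum (leafHalves ρ) + 1)    ≤⟨ root-pays 2≤ρa ⟩
    ρ zero + sum (leafHalves ρ)                ∎
    where
    open ≤-Reasoning
    halves : sum (leafHalves ρ′) ≤ sum (leafHalves ρ) + 1
    halves = subst (_≤ _) (+-identityʳ _) (sum-≤-except b
      (λ c c≢b → ≤-reflexive (halves-others moved c (λ ()) (c≢b ∘ suc-injective)))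
      (subst₂ _≤_ (sym (+-identityʳ _)) (+-comm 1 _) (halves-target moved refl)))
    root-pays : ∀ {x s} → 2 ≤ x → x ∸ 2 + (s + 1) ≤ x + s
    root-pays {suc (suc x)} {s} (s≤s (s≤s _)) = ≤-trans (≤-reflexive (+-assoc-suc x s)) (n≤1+n _)
      where
      +-assoc-suc : ∀ x s → x + (s + 1) ≡ suc (x + s)
      +-assoc-suc = solve-∀
  rootSupply-Moved-≤ {ρ} {ρ′} {suc b} {suc b′} moved b≢b′ 2≤ρa =
    +-mono-≤ (≤-reflexive (Moved.others moved zero (λ ()) (λ ())))
      (sum-≤-pair (b≢b′ ∘ cong suc)
        (λ c c≢b c≢b′ → ≤-reflexive (halves-others moved c (c≢b ∘ suc-injective) (c≢b′ ∘ suc-injective)))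
        pair)
    where
    pair : leafHalves ρ′ b + leafHalves ρ′ b′ ≤ leafHalves ρ b + leafHalves ρ b′
    pair = begin
      leafHalves ρ′ b + leafHalves ρ′ b′         ≤⟨ +-monoʳ-≤ _ (halves-target moved refl) ⟩
      leafHalves ρ′ b + suc (leafHalves ρ b′)    ≡⟨ +-suc _ _ ⟩
      suc (leafHalves ρ′ b) + leafHalves ρ b′    ≡⟨ cong (_+ _) (halves-source moved refl 2≤ρa) ⟩
      leafHalves ρ b + leafHalves ρ b′           ∎
      where open ≤-Reasoning

  module _ (ρ ρ′ : Row m′) (leaves-kept : ∀ b → ρ′ (suc b) ≡ ρ (suc b)) where

    private
      halves-kept : sum (leafHalves ρ′) ≡ sum (leafHalves ρ)
      halves-kept = sum-cong-≗ λ b → cong ⌊_/2⌋ (leaves-kept b)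

    export-rootLoses2 : 2 ≤ ρ zero → ρ′ zero ≡ ρ zero ∸ 2 → suc (export ρ′) ≡ export ρ
    export-rootLoses2 2≤ρ₀ root′ = cong ⌊_/2⌋ (begin
      2 + rootSupply ρ′                           ≡⟨ cong₂ (λ r s → 2 + (r + s)) root′ halves-kept ⟩
      2 + (ρ zero ∸ 2) + sum (leafHalves ρ)       ≡⟨ cong (_+ sum (leafHalves ρ)) (m+[n∸m]≡n 2≤ρ₀) ⟩
      rootSupply ρ                                ∎)
      where open ≡-Reasoning

    export-rootGains1 : ρ′ zero ≡ suc (ρ zero) → export ρ′ ≤ suc (export ρ)
    export-rootGains1 root′ =
      subst (λ r → ⌊ r /2⌋ ≤ suc (export ρ)) (sym (cong₂ _+_ root′ halves-kept))
        (⌊1+n/2⌋≤1+⌊n/2⌋ (rootSupply ρ))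

module QPebbling (n′ m′ : ℕ) where

  n m πQ : ℕ
  n  = suc n′
  m  = suc m′
  πQ = m * n + n + 2

  open Pebbling (Q n m) public
  open PebblingProperties (Q n m) public

  V : Set
  V = Fin n × Fin m

  Grid : Set
  Grid = Fin n → Fin m → ℕ

  GridMoved : Grid → Grid → V → V → Set
  GridMoved F F′ = Moved (uncurry F) (uncurry F′)

  ι : V → Fin (n * m)
  ι = uncurry combine

  coords : Fin (n * m) → V
  coords = remQuot {n} m

  ι-injective : Injective _≡_ _≡_ ι
  ι-injective {j , a} {j′ , a′} ιp≡ιq =
    trans (sym (remQuot-combine j a)) (trans (cong coords ιp≡ιq) (remQuot-combine j′ a′))

  ι-coords : ∀ u → ι (coords u) ≡ u
  ι-coords = combine-remQuot {n} m

  grid : Config → Grid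
  grid f j a = f (combine j a)

  ungrid : Grid → Config
  ungrid F = uncurry F ∘ coords

  grid-ungrid : ∀ F j a → grid (ungrid F) j a ≡ F j a
  grid-ungrid F j a = cong (uncurry F) (remQuot-combine j a)

  weight-rows : ∀ f → weight f ≡ sum λ j → sum (grid f j)
  weight-rows f = trans (weight≡sum f) (sum-combine n f)

  weight-ungrid : ∀ F → weight (ungrid F) ≡ sum λ j → sum (F j)
  weight-ungrid F = trans (weight-rows (ungrid F)) (sum-cong-≗ λ j → sum-cong-≗ (grid-ungrid F j))

  QAdj-irrefl : ∀ {p} → ¬ QAdj n m p p
  QAdj-irrefl (inj₁ (_ , a≢a))     = a≢a refl
  QAdj-irrefl (inj₂ (j≢j , _ , _)) = j≢j refl

  record GridStep (f g : Config) : Set where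
    field
      from to  : V
      adjacent : QAdj n m from to
      enough   : 2 ≤ f (ι from)
      moved    : GridMoved (grid f) (grid g) from to

  gridStep : ∀ {f g} → Step f g → GridStep f g
  gridStep {f} (u , v , adj , 2≤fu , g≗) = record
    { from     = coords u
    ; to       = coords v
    ; adjacent = adj
    ; enough   = subst (λ x → 2 ≤ f x) (sym (ι-coords u)) 2≤fu
    ; moved    = Moved-reindex ι-injective (ι-coords u) (ι-coords v) (move-Moved u≢v g≗)
    }
    where
    u≢v : u ≢ v
    u≢v refl = QAdj-irrefl adj

  ι-adjacent-≢ : ∀ {p q} → QAdj n m p q → ι p ≢ ι q
  ι-adjacent-≢ {p} adj ιp≡ιq = QAdj-irrefl (subst (QAdj n m p) (sym (ι-injective ιp≡ιq)) adj)

  module _ {f : Config} {p q : V} (adj : QAdj n m p q) where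

    fire : 2 ≤ f (ι p) → Reach f (move f (ι p) (ι q))
    fire 2≤ = (ι p , ι q , adj′ , 2≤ , λ _ → refl) ◅ ε
      where
      adj′ : Graph.Adj (Q n m) (ι p) (ι q)
      adj′ = subst₂ (QAdj n m) (sym (remQuot-combine _ _)) (sym (remQuot-combine _ _)) adj

    fire-Moved : GridMoved (grid f) (grid (move f (ι p) (ι q))) p q
    fire-Moved = Moved-reindex ι-injective refl refl (move-Moved (ι-adjacent-≢ adj) λ _ → refl)

    fire-reaches : 2 ≤ f (ι p) → ∃ λ g → Reach f g × 1 ≤ g (ι q)
    fire-reaches 2≤ = _ , fire 2≤ , subst (1 ≤_) (sym (Moved.target fire-Moved)) (s≤s z≤n)

  share : Fin n → Grid → Fin n → ℕ
  share i F j with j ≟ i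
  ... | yes _ = F j zero
  ... | no  _ = export (F j)

  collectible : Fin n → Grid → ℕ
  collectible i F = sum (share i F)

  share-self : ∀ i F → share i F i ≡ F i zero
  share-self i F with i ≟ i
  ... | yes _   = refl
  ... | no  i≢i = contradiction refl i≢i

  share-other : ∀ F {i j} → j ≢ i → share i F j ≡ export (F j)
  share-other F {i} {j} j≢i with j ≟ i
  ... | yes j≡i = contradiction j≡i j≢i
  ... | no  _   = refl

  share-mono : ∀ i F G j → (∀ a → F j a ≤ G j a) → share i F j ≤ share i G j
  share-mono i F G j F≤G with j ≟ i
  ... | yes _ = F≤G zero
  ... | no  _ = export-mono F≤G

  share-cong : ∀ i F G j → (∀ a → F j a ≡ G j a) → share i F j ≡ share i G j
  share-cong i F G j F≡G =
    ≤-antisym (share-mono i F G j (≤-reflexive ∘ F≡G)) (share-mono i G F j (≤-reflexive ∘ sym ∘ F≡G))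

  collectible-mono : ∀ i {F G} → (∀ j a → F j a ≤ G j a) → collectible i F ≤ collectible i G
  collectible-mono i {F} {G} F≤G = sum-mono λ j → share-mono i F G j (F≤G j)

  module _ {F F′ : Grid} {j a j′ a′} (moved : GridMoved F F′ (j , a) (j′ , a′)) where
    open Moved moved

    row-untouched : ∀ {x} → x ≢ j → x ≢ j′ → ∀ c → F′ x c ≡ F x c
    row-untouched x≢j x≢j′ c = others (_ , c) (x≢j ∘ cong proj₁) (x≢j′ ∘ cong proj₁)

    share-untouched : ∀ i {x} → x ≢ j → x ≢ j′ → share i F′ x ≡ share i F x
    share-untouched i {x} x≢j x≢j′ = share-cong i F′ F x (row-untouched x≢j x≢j′)

    Moved-inRow : j ≡ j′ → Moved (F j) (F′ j) a a′
    Moved-inRow refl = record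
      { source = source
      ; target = target
      ; others = λ c c≢a c≢a′ → others (j , c) (c≢a ∘ cong proj₂) (c≢a′ ∘ cong proj₂)
      }

  module _ {F F′ : Grid} {j j′} (moved : GridMoved F F′ (j , zero) (j′ , zero)) (j≢j′ : j ≢ j′) where
    open Moved moved

    share-rootSource : ∀ {i} → j ≢ i → 2 ≤ F j zero → suc (share i F′ j) ≡ share i F j
    share-rootSource {i} j≢i 2≤ = begin
      suc (share i F′ j)   ≡⟨ cong suc (share-other F′ j≢i) ⟩
      suc (export (F′ j))  ≡⟨ export-rootLoses2 (F j) (F′ j) leaves-kept 2≤ source ⟩
      export (F j)         ≡⟨ share-other F j≢i ⟨
      share i F j          ∎
      where
      open ≡-Reasoning
      leaves-kept : ∀ b → F′ j (suc b) ≡ F j (suc b)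
      leaves-kept b = others (j , suc b) (λ ()) (j≢j′ ∘ cong proj₁)

    share-rootTarget : ∀ {i} → share i F′ j′ ≤ suc (share i F j′)
    share-rootTarget {i} with j′ ≟ i
    ... | yes _ = ≤-reflexive target
    ... | no  _ = export-rootGains1 (F j′) (F′ j′) leaves-kept target
      where
      leaves-kept : ∀ b → F′ j′ (suc b) ≡ F j′ (suc b)
      leaves-kept b = others (j′ , suc b) (j≢j′ ∘ sym ∘ cong proj₁) λ ()

    share-rootTarget-self : share j′ F′ j′ ≡ suc (share j′ F j′)
    share-rootTarget-self = trans (share-self j′ F′) (trans target (cong suc (sym (share-self j′ F))))

  collectible-Moved-≤ : ∀ {i F F′ p q} → QAdj n m p q → 2 ≤ uncurry F p → GridMoved F F′ p q →
                        proj₁ p ≢ i → collectible i F′ ≤ collectible i F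
  collectible-Moved-≤ {i} {F} {F′} {j , a} {_ , a′} (inj₁ (refl , a≢a′)) 2≤ moved j≢i = sum-mono pointwise
    where
    pointwise : ∀ x → share i F′ x ≤ share i F x
    pointwise x with x ≟ j
    ... | yes refl = subst₂ _≤_ (sym (share-other F′ j≢i)) (sym (share-other F j≢i))
                       (⌊n/2⌋-mono (rootSupply-Moved-≤ (Moved-inRow moved refl) a≢a′ 2≤))
    ... | no  x≢j  = ≤-reflexive (share-untouched moved i x≢j x≢j)
  collectible-Moved-≤ {i} {F} {F′} {j , a} {j′ , a′} (inj₂ (j≢j′ , a≡0 , a′≡0)) 2≤ moved j≢i
    with refl ← toℕ-injective {j = zero} a≡0 | refl ← toℕ-injective {j = zero} a′≡0 =
    sum-≤-pair j≢j′ (λ x x≢j x≢j′ → ≤-reflexive (share-untouched moved i x≢j x≢j′)) pair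
    where
    open ≤-Reasoning
    pair : share i F′ j + share i F′ j′ ≤ share i F j + share i F j′
    pair = begin
      share i F′ j + share i F′ j′         ≤⟨ +-monoʳ-≤ _ (share-rootTarget moved j≢j′) ⟩
      share i F′ j + suc (share i F j′)    ≡⟨ +-suc _ _ ⟩
      suc (share i F′ j) + share i F j′    ≡⟨ cong (_+ _) (share-rootSource moved j≢j′ j≢i 2≤) ⟩
      share i F j + share i F j′           ∎

  record Blocked (i : Fin n) (b : Fin m′) (F : Grid) : Set where
    field
      target-empty   : F i (suc b) ≡ 0
      leaves-≤1      : ∀ c → F i (suc c) ≤ 1
      collectible-≤1 : collectible i F ≤ 1

  Blocked-mono : ∀ {i b F G} → (∀ j a → F j a ≤ G j a) → Blocked i b G → Blocked i b F
  Blocked-mono {i} {b} F≤G blocked = record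
    { target-empty   = n≤0⇒n≡0 (≤-trans (F≤G i (suc b)) (≤-reflexive target-empty))
    ; leaves-≤1      = λ c → ≤-trans (F≤G i (suc c)) (leaves-≤1 c)
    ; collectible-≤1 = ≤-trans (collectible-mono i F≤G) collectible-≤1
    }
    where open Blocked blocked

  Blocked-Moved : ∀ {i b F F′ p q} → QAdj n m p q → 2 ≤ uncurry F p → GridMoved F F′ p q →
                  Blocked i b F → Blocked i b F′
  Blocked-Moved {i} {b} {F} {F′} {j , a} {j′ , a′} adj 2≤ moved blocked with j ≟ i
  ... | yes refl = contradiction 2≤ (row-idle a)
    where
    open Blocked blocked
    row-idle : ∀ a → ¬ 2 ≤ F i a
    row-idle zero    2≤ = <⇒≱ 2≤ (≤-trans (subst (_≤ collectible i F) (share-self i F) (≤-sum (share i F) i))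
                                             collectible-≤1)
    row-idle (suc c) 2≤ = <⇒≱ 2≤ (leaves-≤1 c)
  ... | no  j≢i  = record
    { target-empty   = trans (leaf-kept b) target-empty
    ; leaves-≤1      = λ c → subst (_≤ 1) (sym (leaf-kept c)) (leaves-≤1 c)
    ; collectible-≤1 = ≤-trans (collectible-Moved-≤ adj 2≤ moved j≢i) collectible-≤1
    }
    where
    open Blocked blocked
    not-target : ∀ {c} → QAdj n m (j , a) (j′ , a′) → (i , suc c) ≢ (j′ , a′)
    not-target (inj₁ (refl , _))     = j≢i ∘ sym ∘ cong proj₁
    not-target (inj₂ (_ , _ , a′≡0)) = λ { refl → 1+n≢0 a′≡0 }
    leaf-kept : ∀ c → F′ i (suc c) ≡ F i (suc c)
    leaf-kept c = Moved.others moved (i , suc c) (j≢i ∘ sym ∘ cong proj₁) (not-target adj)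

  Blocked-reach : ∀ {i b f g} → Reach f g → Blocked i b (grid f) → Blocked i b (grid g)
  Blocked-reach ε        = λ blocked → blocked
  Blocked-reach (s ◅ r) = Blocked-reach r ∘ Blocked-Moved adjacent enough moved
    where open GridStep (gridStep s)

  Blocked⇒¬Solvable : ∀ {i b f} → Blocked i b (grid f) → ¬ Solvable f
  Blocked⇒¬Solvable {i} {b} blocked solvable =
    let g , f↠g , 1≤ = solvable (ι (i , suc b))
    in n≮0 (subst (1 ≤_) (Blocked.target-empty (Blocked-reach f↠g blocked)) 1≤)

  towardRoot : Fin n → Fin n → Fin m → V
  towardRoot i j zero    = i , zero
  towardRoot i j (suc _) = j , zero

  towardRoot-adjacent : ∀ {i j} a → j ≢ i → QAdj n m (j , a) (towardRoot i j a)
  towardRoot-adjacent zero    j≢i = inj₂ (j≢i , refl , refl)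
  towardRoot-adjacent (suc _) _   = inj₁ (refl , λ ())

  collectible-towardRoot : ∀ {i F F′ j} a → j ≢ i → 2 ≤ F j a →
                           GridMoved F F′ (j , a) (towardRoot i j a) → collectible i F ≤ collectible i F′
  collectible-towardRoot {i} {F} {F′} {j} zero j≢i 2≤ moved =
    sum-≤-pair j≢i (λ x x≢j x≢i → ≤-reflexive (sym (share-untouched moved i x≢j x≢i))) (≤-reflexive pair)
    where
    open ≡-Reasoning
    pair : share i F j + share i F i ≡ share i F′ j + share i F′ i
    pair = begin
      share i F j + share i F i            ≡⟨ cong (_+ _) (share-rootSource moved j≢i j≢i 2≤) ⟨
      suc (share i F′ j) + share i F i     ≡⟨ +-suc _ _ ⟨
      share i F′ j + suc (share i F i)     ≡⟨ cong (share i F′ j +_) (share-rootTarget-self moved j≢i) ⟨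
      share i F′ j + share i F′ i          ∎
  collectible-towardRoot {i} {F} {F′} {j} (suc b) j≢i 2≤ moved = sum-mono pointwise
    where
    pointwise : ∀ x → share i F x ≤ share i F′ x
    pointwise x with x ≟ j
    ... | yes refl = ≤-reflexive (trans (share-other F j≢i) (trans
                       (cong ⌊_/2⌋ (sym (rootSupply-leafToRoot (Moved-inRow moved refl) 2≤)))
                       (sym (share-other F′ j≢i))))
    ... | no  x≢j  = ≤-reflexive (sym (share-untouched moved i x≢j x≢j))

  collectible-settled : ∀ i F → (∀ j → j ≢ i → ∀ a → F j a ≤ 1) → collectible i F ≤ F i zero
  collectible-settled i F settled = subst₂ _≤_ (+-identityʳ _) (cong (_+ F i zero) (sum-zero n))
    (sum-≤-except i
      (λ j j≢i → ≤-reflexive (trans (share-other F j≢i) (export-≤1 (settled j j≢i))))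
      (≤-reflexive (trans (cong (_+ 0) (share-self i F)) (+-comm (F i zero) 0))))

  collect : ∀ i f → ∃ λ g → Reach f g × collectible i (grid f) ≤ grid g i zero
  collect i f = go f (<-wellFounded (weight f))
    where
    go : ∀ f → Acc _<_ (weight f) → ∃ λ g → Reach f g × collectible i (grid f) ≤ grid g i zero
    go f (acc smaller) with any? (λ j → ¬? (j ≟ i) ×-dec any? λ a → 2 ≤? grid f j a)
    ... | no settled = f , ε , collectible-settled i (grid f)
            λ j j≢i a → ≤-pred (≰⇒> λ 2≤ → settled (j , j≢i , a , 2≤))
    ... | yes (j , j≢i , a , 2≤) =
      let adj = towardRoot-adjacent a j≢i
          g , f′↠g , collected = go _ (smaller (weight-move-< (ι-adjacent-≢ adj) 2≤))
      in g , fire adj 2≤ ◅◅ f′↠g , ≤-trans (collectible-towardRoot a j≢i 2≤ (fire-Moved adj)) collected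

  2*collectible≤weight : ∀ i f → grid f i zero ≡ 0 → 2 * collectible i (grid f) ≤ weight f
  2*collectible≤weight i f root≡0 = begin
    2 * collectible i (grid f)            ≡⟨ *-distribˡ-sum 2 (share i (grid f)) ⟩
    sum (λ j → 2 * share i (grid f) j)    ≤⟨ sum-mono pointwise ⟩
    sum (λ j → sum (grid f j))            ≡⟨ weight-rows f ⟨
    weight f                              ∎
    where
    open ≤-Reasoning
    pointwise : ∀ j → 2 * share i (grid f) j ≤ sum (grid f j)
    pointwise j with j ≟ i
    ... | yes refl = subst (λ x → 2 * x ≤ sum (grid f j)) (sym root≡0) z≤n
    ... | no  _    = 2*export≤sum (grid f j)

  weight-bound : ∀ i f → weight f ≤ sum (grid f i ∘ suc) + 4 * collectible i (grid f) + n′ * (m′ + 2)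
  weight-bound i f = +-cancelʳ-≤ c _ _ (begin
    weight f + c                                 ≡⟨ cong (_+ c) (weight-rows f) ⟩
    sum (λ j → sum (F j)) + c                    ≤⟨ sum-≤-except i otherRow ownRow ⟩
    sum (λ j → 4 * share i F j + c) + L          ≡⟨ cong (_+ L) (∑-distrib-+ {n} ((4 *_) ∘ share i F) (λ _ → c)) ⟩
    sum (λ j → 4 * share i F j) + sum {n} (λ _ → c) + L
      ≡⟨ cong₂ (λ s t → s + t + L) (sym (*-distribˡ-sum 4 (share i F))) (sum-const n c) ⟩
    4 * collectible i F + n * c + L              ≡⟨ regroup (collectible i F) c L n′ ⟩
    L + 4 * collectible i F + n′ * c + c         ∎)
    where
    open ≤-Reasoning
    F = grid f
    L = sum (F i ∘ suc)
    c = m′ + 2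
    otherRow : ∀ j → j ≢ i → sum (F j) ≤ 4 * share i F j + c
    otherRow j j≢i = subst (λ s → sum (F j) ≤ 4 * s + c) (sym (share-other F j≢i)) (sum≤4*export (F j))
    ownRow : sum (F i) + c ≤ 4 * share i F i + c + L
    ownRow rewrite share-self i F =
      ≤-trans (+-monoˡ-≤ c (+-monoˡ-≤ L (m≤n*m (F i zero) 4))) (≤-reflexive (swap (4 * F i zero) L c))
      where
      swap : ∀ x y z → x + y + z ≡ x + z + y
      swap = solve-∀
    regroup : ∀ C c L n′ → 4 * C + suc n′ * c + L ≡ L + 4 * C + n′ * c + c
    regroup = solve-∀

  module _ {f : Config} (w≡πQ : weight f ≡ πQ) (i : Fin n) (row≤1 : ∀ a → grid f i a ≤ 1) where

    private
      rich : m′ + 4 ≤ sum (grid f i ∘ suc) + 4 * collectible i (grid f)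
      rich = +-cancelʳ-≤ (n′ * (m′ + 2)) _ _
        (≤-trans (≤-reflexive (sym (trans w≡πQ (split n′ m′)))) (weight-bound i f))
        where
        split : ∀ n′ m′ → suc m′ * suc n′ + suc n′ + 2 ≡ m′ + 4 + n′ * (m′ + 2)
        split = solve-∀

    collectible-root : 1 ≤ collectible i (grid f)
    collectible-root = *-cancelˡ-≤ 4 (+-cancelˡ-≤ m′ _ _
      (≤-trans rich (+-monoˡ-≤ _ (sum-≤1 (row≤1 ∘ suc)))))

    collectible-leaf : ∀ {b} → grid f i (suc b) ≡ 0 → 2 ≤ collectible i (grid f)
    collectible-leaf gap = *-cancelˡ-< 4 1 _ (+-cancelˡ-≤ L _ _ (begin
      L + 5         ≡⟨ +-suc L 4 ⟩
      suc L + 4     ≤⟨ +-monoˡ-≤ 4 (sum-≤1-gap (row≤1 ∘ suc) gap) ⟩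
      m′ + 4        ≤⟨ rich ⟩
      L + 4 * collectible i (grid f) ∎))
      where
      open ≤-Reasoning
      L = sum (grid f i ∘ suc)

  Solvable-grid : ∀ {f} → (∀ i a → ∃ λ g → Reach f g × 1 ≤ g (ι (i , a))) → Solvable f
  Solvable-grid {f} reaches v = subst (λ u → ∃ λ g → Reach f g × 1 ≤ g u) (ι-coords v)
    (reaches (proj₁ (coords v)) (proj₂ (coords v)))

  weight≡πQ⇒Solvable : ∀ f → weight f ≡ πQ → Solvable f
  weight≡πQ⇒Solvable f w≡πQ = Solvable-grid reaches
    where
    reaches : ∀ i a → ∃ λ g → Reach f g × 1 ≤ g (ι (i , a))
    reaches i a with 1 ≤? grid f i a
    ... | yes occupied = f , ε , occupied
    ... | no  empty with any? (λ a′ → 2 ≤? grid f i a′)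
    ...   | yes (a′ , 2≤) = fire-reaches {f} {i , a′} {i , a} (inj₁ (refl , a′≢a)) 2≤
      where
      a′≢a : a′ ≢ a
      a′≢a refl = empty (≤-trans (s≤s z≤n) 2≤)
    ...   | no  poor = viaRoot a empty (collect i f)
      where
      row≤1 : ∀ a → grid f i a ≤ 1
      row≤1 a = ≤-pred (≰⇒> λ 2≤ → poor (a , 2≤))
      viaRoot : ∀ a → ¬ 1 ≤ grid f i a → (∃ λ g → Reach f g × collectible i (grid f) ≤ grid g i zero) →
                ∃ λ g → Reach f g × 1 ≤ g (ι (i , a))
      viaRoot zero    _     (g , f↠g , gathered) = g , f↠g , ≤-trans (collectible-root w≡πQ i row≤1) gathered
      viaRoot (suc b) empty (g , f↠g , gathered) =
        let h , g↠h , 1≤ = fire-reaches {g} {i , zero} {i , suc b} (inj₁ (refl , λ ())) 2≤root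
        in h , f↠g ◅◅ g↠h , 1≤
        where
        2≤root : 2 ≤ grid g i zero
        2≤root = ≤-trans (collectible-leaf w≡πQ i row≤1 (n≤0⇒n≡0 (≤-pred (≰⇒> empty)))) gathered

  pile : Grid
  pile zero    zero    = 4
  pile zero    (suc _) = 0
  pile (suc _) _       = 0

  weight-pile : weight (ungrid pile) ≡ 4
  weight-pile = trans (weight-ungrid pile)
    (cong₂ (λ x y → 4 + x + y) (sum-zero m′) (trans (sum-cong-≗ {n′} λ _ → sum-zero m) (sum-zero n′)))

  pile-Solvable : Solvable (ungrid pile)
  pile-Solvable = Solvable-grid reaches
    where
    f = ungrid pile
    2≤origin : 2 ≤ f (ι (zero , zero))
    2≤origin = subst (2 ≤_) (sym (grid-ungrid pile zero zero)) (s≤s (s≤s z≤n))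
    reaches : ∀ i a → ∃ λ g → Reach f g × 1 ≤ g (ι (i , a))
    reaches zero    zero    = f , ε , ≤-trans (s≤s z≤n) 2≤origin
    reaches zero    (suc b) = fire-reaches {f} {zero , zero} {zero , suc b} (inj₁ (refl , λ ())) 2≤origin
    reaches (suc i) zero    = fire-reaches {f} {zero , zero} {suc i , zero} (inj₂ ((λ ()) , refl , refl)) 2≤origin
    reaches (suc i) (suc b) =
      let h , g₂↠h , 1≤h = fire-reaches {g₂} {suc i , zero} {suc i , suc b} (inj₁ (refl , λ ())) 2≤g₂
      in h , fire adj 2≤origin ◅◅ fire adj 2≤g₁ ◅◅ g₂↠h , 1≤h
      where
      adj : QAdj n m (zero , zero) (suc i , zero)
      adj = inj₂ ((λ ()) , refl , refl)
      g₁ = move f (ι (zero , zero)) (ι (suc i , zero))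
      g₂ = move g₁ (ι (zero , zero)) (ι (suc i , zero))
      2≤g₁ : 2 ≤ g₁ (ι (zero , zero))
      2≤g₁ = subst (2 ≤_) (sym (trans (Moved.source (fire-Moved {f} adj))
                                      (cong (_∸ 2) (grid-ungrid pile zero zero))))
               (s≤s (s≤s z≤n))
      2≤g₂ : 2 ≤ g₂ (ι (suc i , zero))
      2≤g₂ = subst (2 ≤_) (sym (trans (Moved.target (fire-Moved {g₁} adj))
                                      (cong suc (Moved.target (fire-Moved {f} adj)))))
               (s≤s (s≤s z≤n))

module PebblingLowerBound (n″ k : ℕ) where
  open QPebbling (suc n″) (suc k)

  extremalRow : ℕ → Row (suc k)
  extremalRow t zero          = 0
  extremalRow t (suc zero)    = t
  extremalRow t (suc (suc _)) = 1

  extremal : Grid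
  extremal zero          = extremalRow 0
  extremal (suc zero)    = extremalRow 7
  extremal (suc (suc _)) = extremalRow 3

  sum-extremalRow : ∀ t → sum (extremalRow t) ≡ t + k
  sum-extremalRow t = cong (t +_) (trans (sum-const k 1) (*-identityʳ k))

  export-extremalRow : ∀ t → export (extremalRow t) ≡ ⌊ ⌊ t /2⌋ /2⌋
  export-extremalRow t =
    trans (cong (λ s → ⌊ ⌊ t /2⌋ + s /2⌋) (sum-zero k)) (cong ⌊_/2⌋ (+-identityʳ ⌊ t /2⌋))

  suc-weight-extremal : suc (weight (ungrid extremal)) ≡ πQ
  suc-weight-extremal = begin
    suc (weight (ungrid extremal))       ≡⟨ cong suc (weight-ungrid extremal) ⟩
    suc (sum (extremalRow 0) + (sum (extremalRow 7) + sum {n″} (λ _ → sum (extremalRow 3))))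
                                         ≡⟨ cong suc (cong₂ _+_ (sum-extremalRow 0)
                                              (cong₂ _+_ (sum-extremalRow 7) (sum-const n″ (sum (extremalRow 3))))) ⟩
    suc (k + (7 + k + n″ * sum (extremalRow 3)))
                                         ≡⟨ cong (λ s → suc (k + (7 + k + n″ * s))) (sum-extremalRow 3) ⟩
    suc (k + (7 + k + n″ * (3 + k)))     ≡⟨ count n″ k ⟩
    πQ                                   ∎
    where
    open ≡-Reasoning
    count : ∀ n″ k → suc (k + (7 + k + n″ * (3 + k))) ≡ suc (suc k) * suc (suc n″) + suc (suc n″) + 2
    count = solve-∀

  extremal-Blocked : Blocked zero zero extremal
  extremal-Blocked = record
    { target-empty   = refl
    ; leaves-≤1      = λ { zero → z≤n ; (suc _) → ≤-refl }
    ; collectible-≤1 = ≤-reflexive (cong₂ _+_ (export-extremalRow 7)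
                         (trans (sum-cong-≗ {n″} λ _ → export-extremalRow 3) (sum-zero n″)))
    }

  weight<πQ⇒∃¬Solvable : ∀ j → j < πQ → ∃ λ f → weight f ≡ j × ¬ Solvable f
  weight<πQ⇒∃¬Solvable j j<πQ =
    let f , f≤ , ∑f≡j = ≤sum⇒∃below (ungrid extremal) j≤
    in f , trans (weight≡sum f) ∑f≡j ,
       Blocked⇒¬Solvable (Blocked-mono (λ i a → subst (grid f i a ≤_) (grid-ungrid extremal i a) (f≤ _))
                                        extremal-Blocked)
    where
    j≤ : j ≤ sum (ungrid extremal)
    j≤ = subst (j ≤_) (weight≡sum (ungrid extremal)) (≤-pred (subst (j <_) (sym suc-weight-extremal) j<πQ))

module OptimalLowerBound (n‴ k : ℕ) where
  open QPebbling (suc (suc n‴)) (suc k)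

  light-emptyRow : ∀ f c → weight f ≤ 3 → 2 ≤ sum (grid f c) → ∃ λ i → ∀ a → grid f i a ≡ 0
  light-emptyRow f c w≤3 2≤row =
    let x , rowx≡0 = sum<⇒∃≡0 (removeAt rows c) (s≤s (≤-trans others≤1 (s≤s z≤n)))
    in punchIn c x , λ a → n≤0⇒n≡0 (≤-trans (≤-sum (grid f (punchIn c x)) a) (≤-reflexive rowx≡0))
    where
    rows : Vector ℕ n
    rows j = sum (grid f j)
    others≤1 : sum (removeAt rows c) ≤ 1
    others≤1 = +-cancelˡ-≤ 2 _ _ (begin
      2 + sum (removeAt rows c)        ≤⟨ +-monoˡ-≤ _ 2≤row ⟩
      rows c + sum (removeAt rows c)   ≡⟨ trans (weight-rows f) (sum-remove {i = c} rows) ⟨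
      weight f                         ≤⟨ w≤3 ⟩
      3                                ∎)
      where open ≤-Reasoning

  emptyRow-Blocked : ∀ f i → weight f ≤ 3 → (∀ a → grid f i a ≡ 0) → Blocked i zero (grid f)
  emptyRow-Blocked f i w≤3 empty = record
    { target-empty   = empty (suc zero)
    ; leaves-≤1      = λ c → ≤-trans (≤-reflexive (empty (suc c))) z≤n
    ; collectible-≤1 = ≤-pred (*-cancelˡ-< 2 (collectible i (grid f)) 2
                         (s≤s (≤-trans (2*collectible≤weight i f (empty zero)) w≤3)))
    }

  light⇒¬Solvable : ∀ f → weight f ≤ 3 → ¬ Solvable f
  light⇒¬Solvable f w≤3 with any? (λ u → 2 ≤? f u)
  ... | no  frozen =
    let _ , fx≡0 = sum<⇒∃≡0 f (≤-trans (s≤s (subst (_≤ 3) (weight≡sum f) w≤3)) 4≤nm)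
    in frozen⇒¬Solvable frozen fx≡0
    where
    4≤nm : 4 ≤ n * m
    4≤nm = *-mono-≤ {2} {n} {2} {m} (s≤s (s≤s z≤n)) (s≤s (s≤s z≤n))
  ... | yes (u , 2≤fu) =
    let i , empty = light-emptyRow f c w≤3 (≤-trans 2≤fu′ (≤-sum (grid f c) a))
    in Blocked⇒¬Solvable (emptyRow-Blocked f i w≤3 empty)
    where
    c = proj₁ (coords u)
    a = proj₂ (coords u)
    2≤fu′ : 2 ≤ grid f c a
    2≤fu′ = subst (λ x → 2 ≤ f x) (sym (ι-coords u)) 2≤fu

  Solvable⇒4≤weight : ∀ f → Solvable f → 4 ≤ weight f
  Solvable⇒4≤weight f solvable with 4 ≤? weight f
  ... | yes 4≤ = 4≤
  ... | no  4≰ = contradiction solvable (light⇒¬Solvable f (≤-pred (≰⇒> 4≰)))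

mainTheorem6 : ∀ (n m : ℕ) → 2 < n → 2 ≤ m →
    Pebbling.IsPebblingNumber (Q n m) (m * n + n + 2) ×
    Pebbling.IsOptimalPebblingNumber (Q n m) 4
mainTheorem6 (suc (suc (suc n‴))) (suc (suc k)) _ _ =
  (weight≡πQ⇒Solvable , PebblingLowerBound.weight<πQ⇒∃¬Solvable (suc n‴) k) ,
  ((ungrid pile , weight-pile , pile-Solvable) , OptimalLowerBound.Solvable⇒4≤weight n‴ k)
  where open QPebbling (suc (suc n‴)) (suc k)
mainTheorem6 (suc (suc zero)) _          (s≤s (s≤s ())) _
mainTheorem6 (suc zero)       _          (s≤s ())       _
mainTheorem6 zero             _          ()             _
mainTheorem6 _                (suc zero) _              (s≤s ())
mainTheorem6 _                zero       _              ()
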